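{- For each $n\ge1$, the sets $\operatorname{Av}_n(132,\underline{321})$, $\operatorname{Av}_n(231,\underline{321})$, and $\operatorname{Av}_n(132,\underline{123})$ are in bijection. Consequently $|\operatorname{Av}_n(132,\underline{321})|=M_n$.
   Context: $S_n$ is the set of permutations of $[n]$ in one-line notation. Two sequences of distinct integers have the same relative order if replacing the $i$th smallest entry of each by $i$ yields the same word; a permutation contains $\sigma$ classically (resp. consecutively) if some subsequence (resp. consecutive subsequence) has the same relative order as $\sigma$, and avoids it otherwise. $\operatorname{Av}_n(\tau,\underline{\rho})$ is the set of permutations in $S_n$ avoiding $\tau$ classically and $\rho$ consecutively. Motzkin numbers: $M_0=M_1=1$ and $M_n=M_{n-1}+\sum_{i=0}^{n-2}M_iM_{n-2-i}$ for $n\ge2$. -}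

module Defs where

open import Data.Nat as ℕ using (ℕ; zero; suc; _+_; _*_; _∸_)
open import Data.Fin as Fin using (Fin; toℕ)
open import Data.Vec using (Vec; lookup; []; _∷_)
open import Data.List using (map; upTo)
open import Data.Nat.ListAction using (sum)
open import Data.Product using (Σ; _×_)
open import Data.Refinement using (Refinement)
open import Function.Bundles using (_⇔_)
open import Relation.Binary.PropositionalEquality using (_≡_)
open import Relation.Nullary using (¬_)

-- We use the values 0,…,n-1
-- (Fin n) instead of 1,…,n; this is a harmless relabelling.
IsPerm : {n : ℕ} → Vec (Fin n) n → Set
IsPerm {n} w = ∀ (i j : Fin n) → lookup w i ≡ lookup w j → i ≡ j

SameRelOrder : {k a b : ℕ} → (Fin k → Fin a) → (Fin k → Fin b) → Set
SameRelOrder {k} x y = ∀ (i j : Fin k) → (x i Fin.< x j) ⇔ (y i Fin.< y j)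

ContainsClassical : {n k : ℕ} → Vec (Fin n) n → Vec (Fin k) k → Set
ContainsClassical {n} {k} π σ =
  Σ (Fin k → Fin n) λ f →
    (∀ (i j : Fin k) → i Fin.< j → f i Fin.< f j)
    × SameRelOrder (λ i → lookup π (f i)) (lookup σ)

ContainsConsecutive : {n k : ℕ} → Vec (Fin n) n → Vec (Fin k) k → Set
ContainsConsecutive {n} {k} π σ =
  Σ (Fin k → Fin n) λ f →
    (∀ (i j : Fin k) → toℕ j ≡ suc (toℕ i) → toℕ (f j) ≡ suc (toℕ (f i)))
    × SameRelOrder (λ i → lookup π (f i)) (lookup σ)

-- The membership proof is proof-irrelevant, so two elements are equal iff
-- their underlying words are equal (these are genuinely sets of permutations).
Av : (n : ℕ) {k l : ℕ} → Vec (Fin k) k → Vec (Fin l) l → Set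
Av n τ ρ = Refinement (Vec (Fin n) n) λ π →
  IsPerm π × ¬ ContainsClassical π τ × ¬ ContainsConsecutive π ρ

-- Patterns (values shifted down by one: 132 ↦ 0 2 1, etc.).
p132 p231 p321 p123 : Vec (Fin 3) 3
p132 = Fin.zero ∷ Fin.suc (Fin.suc Fin.zero) ∷ Fin.suc Fin.zero ∷ []
p231 = Fin.suc Fin.zero ∷ Fin.suc (Fin.suc Fin.zero) ∷ Fin.zero ∷ []
p321 = Fin.suc (Fin.suc Fin.zero) ∷ Fin.suc Fin.zero ∷ Fin.zero ∷ []
p123 = Fin.zero ∷ Fin.suc Fin.zero ∷ Fin.suc (Fin.suc Fin.zero) ∷ []

-- M is the Motzkin sequence: M₀ = M₁ = 1 and
-- M_{n} = M_{n-1} + Σ_{i=0}^{n-2} M_i M_{n-2-i} for n ≥ 2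
-- (written with n+2 in place of n; upTo (suc m) = [0, …, m]).
IsMotzkin : (ℕ → ℕ) → Set
IsMotzkin M =
  (M 0 ≡ 1) × (M 1 ≡ 1) ×
  (∀ m → M (suc (suc m)) ≡ M (suc m) + sum (map (λ i → M i * M (m ∸ i)) (upTo (suc m))))

-- Writing a 132-avoiding permutation of [0, n] as α n β, every entry of α exceeds every entry of
-- β, so it is determined by k = |β| and the two standardized blocks, both again 132-avoiding.
-- Forbidding a consecutive 321 only constrains the junction at n (β may not start with a descent),
-- and forbidding a consecutive 123 only forbids α to end with an ascent. Counting the classes
-- with these end conditions the same way yields the Motzkin recurrence in convolution form,
-- M (n + 1) = Σ_k M′ k · M (n - k) with M′ 0 = 1 and M′ (j + 1) = M j, for both classes.
-- Reversal maps the permutations avoiding 231 and a consecutive 321 onto those avoiding 132 and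
-- a consecutive 123.

module Submission where

open import Defs
open import Data.Empty using (⊥; ⊥-elim; ⊥-elim-irr)
open import Data.Fin as Fin using (Fin; toℕ; fromℕ<)
open import Data.Fin.Patterns using (0F; 1F; 2F)
open import Data.Fin.Properties using (toℕ-fromℕ<; toℕ-injective; toℕ<n; +↔⊎; *↔×)
import Data.Fin.Properties as Fin
open import Data.Irrelevant using ([_])
open import Data.List using (List; []; _∷_; _++_; map; length; applyUpTo; upTo)
open import Data.List.Membership.Propositional using (_∈_; _∉_)
open import Data.List.Membership.Propositional.Properties
  using (∈-++⁺ˡ; ∈-++⁺ʳ; ∈-++⁻; ∈-map⁻; ∈-∃++; ∈-applyUpTo⁺)
open import Data.List.Properties
  using (length-++; length-map; length-applyUpTo; ∷-injective; applyUpTo-∷ʳ; map-upTo)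
import Data.List.Properties as List
open import Data.List.Relation.Binary.Sublist.Propositional
  using ([]; _∷_; _∷ʳ_; ⊆-refl; ⊆-trans; from∈; minimum) renaming (_⊆_ to _⊑_; lookup to ⊑-lookup)
import Data.List.Relation.Binary.Sublist.Propositional.Properties as Sublist
open import Data.List.Relation.Binary.Subset.Propositional using (_⊆_)
open import Data.List.Relation.Unary.All as All using (All; []; _∷_)
import Data.List.Relation.Unary.All.Properties as All
open import Data.List.Relation.Unary.AllPairs using ([]; _∷_)
open import Data.List.Relation.Unary.Any as Any using (here; there)
open import Data.List.Relation.Unary.Unique.Propositional using (Unique)
import Data.List.Relation.Unary.Unique.Propositional.Properties as Unique
open import Data.Nat using (ℕ; zero; suc; _+_; _*_; _∸_; _≤_; _<_; _≟_; z≤n; s≤s; z<s)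
open import Data.Nat.DivMod using (_mod_; m<n⇒m%n≡m)
open import Data.List.Membership.DecPropositional _≟_ using (_∈?_)
open import Data.Nat.Induction using (<-rec)
open import Data.Nat.ListAction using (sum)
open import Data.Nat.ListAction.Properties using (sum-++)
open import Data.Nat.Properties
open import Data.Product using (Σ; ∃; ∃-syntax; _×_; _,_; proj₁; proj₂)
open import Data.Product.Function.NonDependent.Propositional using (_×-↔_)
open import Data.Refinement using (Refinement; _,_; value-injective)
open import Data.Sum using (_⊎_; inj₁; inj₂)
open import Data.Sum.Function.Propositional using (_⊎-↔_)
open import Data.Vec using (Vec; []; _∷_)
import Data.Vec as Vec
import Data.Vec.Properties as Vec
open import Function using (_∘_)
open import Function.Bundles using (_⇔_; mk⇔; Equivalence; _↔_; mk↔ₛ′)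
open import Function.Properties.Inverse using (↔-trans; ↔-sym)
open import Relation.Binary.Definitions using (tri<; tri≈; tri>)
open import Relation.Binary.PropositionalEquality
open import Relation.Nullary using (¬_; yes; no; contradiction)
open import Relation.Nullary.Decidable.Core using (recompute)

-- Permutations of [0, n) as lists

record Perm (n : ℕ) (xs : List ℕ) : Set where
  constructor mkPerm
  field
    unique  : Unique xs
    bounded : All (_< n) xs
    length≡ : length xs ≡ n

open Perm public

unique-++⁻ˡ : ∀ xs {ys : List ℕ} → Unique (xs ++ ys) → Unique xs
unique-++⁻ˡ [] _ = []
unique-++⁻ˡ (x ∷ xs) (x∉ ∷ u) = All.++⁻ˡ xs x∉ ∷ unique-++⁻ˡ xs u

unique-++⁻ʳ : ∀ xs {ys : List ℕ} → Unique (xs ++ ys) → Unique ys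
unique-++⁻ʳ [] u = u
unique-++⁻ʳ (x ∷ xs) (_ ∷ u) = unique-++⁻ʳ xs u

unique-++⇒disjoint : ∀ xs {ys : List ℕ} {v} → Unique (xs ++ ys) → v ∈ xs → v ∉ ys
unique-++⇒disjoint (x ∷ xs) (x∉ ∷ _) (here refl) v∈ys = All.lookup x∉ (∈-++⁺ʳ xs v∈ys) refl
unique-++⇒disjoint (x ∷ xs) (_ ∷ u) (there v∈xs) = unique-++⇒disjoint xs u v∈xs

∈-remove : ∀ as {bs : List ℕ} {x y} → y ∈ as ++ x ∷ bs → y ≢ x → y ∈ as ++ bs
∈-remove as y∈ y≢x with ∈-++⁻ as y∈
... | inj₁ y∈as = ∈-++⁺ˡ y∈as
... | inj₂ (here y≡x) = contradiction y≡x y≢x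
... | inj₂ (there y∈bs) = ∈-++⁺ʳ as y∈bs

length-insert : ∀ (as : List ℕ) {x} bs → length (as ++ x ∷ bs) ≡ suc (length (as ++ bs))
length-insert [] bs = refl
length-insert (_ ∷ as) bs = cong suc (length-insert as bs)

unique⊆⇒length≤ : ∀ {xs ys : List ℕ} → Unique xs → xs ⊆ ys → length xs ≤ length ys
unique⊆⇒length≤ {[]} _ _ = z≤n
unique⊆⇒length≤ {x ∷ xs} (x∉ ∷ u) xs⊆ys with ∈-∃++ (xs⊆ys (here refl))
... | as , bs , refl = begin
  suc (length xs)         ≤⟨ s≤s (unique⊆⇒length≤ u xs⊆as++bs) ⟩
  suc (length (as ++ bs)) ≡⟨ length-insert as bs ⟨
  length (as ++ x ∷ bs)   ∎
  where
  open ≤-Reasoning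
  xs⊆as++bs : xs ⊆ as ++ bs
  xs⊆as++bs y∈xs = ∈-remove as (xs⊆ys (there y∈xs)) (All.lookup x∉ y∈xs ∘ sym)

interval : ℕ → ℕ → List ℕ
interval a b = applyUpTo (a +_) (b ∸ a)

∈-interval⁺ : ∀ {a b x} → a ≤ x → x < b → x ∈ interval a b
∈-interval⁺ {a} {b} a≤x x<b =
  subst (_∈ interval a b) (m+[n∸m]≡n a≤x) (∈-applyUpTo⁺ (a +_) (∸-monoˡ-< x<b a≤x))

unique-in-interval⇒length≤ : ∀ {a b} {xs : List ℕ} → Unique xs →
  (∀ {x} → x ∈ xs → a ≤ x × x < b) → length xs ≤ b ∸ a
unique-in-interval⇒length≤ {a} {b} u inside = subst (_ ≤_) (length-applyUpTo (a +_) (b ∸ a))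
  (unique⊆⇒length≤ u λ x∈ → ∈-interval⁺ (proj₁ (inside x∈)) (proj₂ (inside x∈)))

perm⇒∈ : ∀ {n xs v} → Perm n xs → v < n → v ∈ xs
perm⇒∈ {n} {xs} {v} p v<n with v ∈? xs
... | yes v∈xs = v∈xs
... | no v∉xs = contradiction (subst (_≤ length avoiding) (length≡ p) counted) (<⇒≱ short)
  where
  open ≤-Reasoning
  avoiding = interval 0 v ++ interval (suc v) n
  counted : length xs ≤ length avoiding
  counted = unique⊆⇒length≤ (unique p) sorted
    where
    sorted : xs ⊆ avoiding
    sorted {x} x∈xs with <-cmp x v
    ... | tri< x<v _ _ = ∈-++⁺ˡ (∈-interval⁺ z≤n x<v)
    ... | tri≈ _ refl _ = contradiction x∈xs v∉xs
    ... | tri> _ _ v<x = ∈-++⁺ʳ (interval 0 v) (∈-interval⁺ v<x (All.lookup (bounded p) x∈xs))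
  short : length avoiding < n
  short = begin-strict
    length avoiding                                     ≡⟨ length-++ (interval 0 v) ⟩
    length (interval 0 v) + length (interval (suc v) n) ≡⟨ cong₂ _+_ (length-applyUpTo _ v)
                                                                     (length-applyUpTo _ (n ∸ suc v)) ⟩
    v + (n ∸ suc v)                                     <⟨ ≤-refl ⟩
    suc v + (n ∸ suc v)                                 ≡⟨ m+[n∸m]≡n v<n ⟩
    n                                                   ∎

module _ {N} {L H : List ℕ} (uL : Unique L) (uH : Unique H) (bL : All (_< N) L) (bH : All (_< N) H)
         (sizes : length L + length H ≡ N) (L<H : ∀ {l h} → l ∈ L → h ∈ H → l < h) where

  lower-block-bounded : All (_< length L) L
  lower-block-bounded = All.tabulate λ {l} l∈L → ≰⇒> λ |L|≤l →
    let l<N = All.lookup bL l∈L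
        |H|≤ = unique-in-interval⇒length≤ uH λ h∈H → L<H l∈L h∈H , All.lookup bH h∈H
    in <-irrefl refl (begin-strict
      N                       ≡⟨ sizes ⟨
      length L + length H     ≤⟨ +-mono-≤ |L|≤l |H|≤ ⟩
      l + (N ∸ suc l)         <⟨ ≤-refl ⟩
      suc l + (N ∸ suc l)     ≡⟨ m+[n∸m]≡n l<N ⟩
      N                       ∎)
    where open ≤-Reasoning

  upper-block-bounded : All (length L ≤_) H
  upper-block-bounded = All.tabulate λ {h} h∈H → ≮⇒≥ λ h<|L| →
    <⇒≱ h<|L| (unique-in-interval⇒length≤ uL λ l∈L → z≤n , L<H l∈L h∈H)

shift unshift : ℕ → List ℕ → List ℕ
shift c = map (_+ c)
unshift c = map (_∸ c)

shift-unshift : ∀ c {xs} → All (c ≤_) xs → shift c (unshift c xs) ≡ xs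
shift-unshift c [] = refl
shift-unshift c (c≤x ∷ c≤xs) = cong₂ _∷_ (m∸n+n≡m c≤x) (shift-unshift c c≤xs)

unshift-shift : ∀ c xs → unshift c (shift c xs) ≡ xs
unshift-shift c [] = refl
unshift-shift c (x ∷ xs) = cong₂ _∷_ (m+n∸n≡m x c) (unshift-shift c xs)

∈-shift⁻ : ∀ c {xs y} → y ∈ shift c xs → ∃ λ x → x ∈ xs × y ≡ x + c
∈-shift⁻ c = ∈-map⁻ (_+ c)

module AroundMax {n : ℕ} (α β : List ℕ) (p : Perm (suc n) (α ++ n ∷ β)) where

  unique-α : Unique α
  unique-α = unique-++⁻ˡ α (unique p)

  unique-nβ : Unique (n ∷ β)
  unique-nβ = unique-++⁻ʳ α (unique p)

  unique-β : Unique β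
  unique-β with _ ∷ uβ ← unique-nβ = uβ

  below-α : All (_< n) α
  below-α = All.tabulate λ {x} x∈α → ≤∧≢⇒<
    (m<1+n⇒m≤n (All.lookup (bounded p) (∈-++⁺ˡ x∈α)))
    (λ { refl → unique-++⇒disjoint α (unique p) x∈α (here refl) })

  below-β : All (_< n) β
  below-β with n∉β ∷ _ ← unique-nβ = All.tabulate λ {x} x∈β → ≤∧≢⇒<
    (m<1+n⇒m≤n (All.lookup (bounded p) (∈-++⁺ʳ α (there x∈β))))
    (λ x≡n → All.lookup n∉β x∈β (sym x≡n))

  sizes : length α + length β ≡ n
  sizes = suc-injective (begin
    suc (length α + length β) ≡⟨ +-suc (length α) (length β) ⟨
    length α + length (n ∷ β) ≡⟨ length-++ α ⟨
    length (α ++ n ∷ β)       ≡⟨ length≡ p ⟩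
    suc n                     ∎)
    where open ≡-Reasoning

  split-above : ∀ {k} → k ≡ length β → (∀ {a b} → a ∈ α → b ∈ β → b < a) →
    Perm (n ∸ k) (unshift k α) × Perm k β × shift k (unshift k α) ≡ α
  split-above refl β<α =
    mkPerm (Unique.map⁻ (subst Unique (sym α≡) unique-α)) reduced (trans (length-map _ α) size-α) ,
    mkPerm unique-β (lower-block-bounded unique-β unique-α below-β below-α sizes′ β<α′) refl ,
    α≡
    where
    sizes′ : length β + length α ≡ n
    sizes′ = trans (+-comm (length β) (length α)) sizes
    β<α′ : ∀ {b a} → b ∈ β → a ∈ α → b < a
    β<α′ b∈β a∈α = β<α a∈α b∈β
    high : All (length β ≤_) α
    high = upper-block-bounded unique-β unique-α below-β below-α sizes′ β<α′
    α≡ : shift (length β) (unshift (length β) α) ≡ α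
    α≡ = shift-unshift (length β) high
    size-α : length α ≡ n ∸ length β
    size-α = trans (sym (m+n∸n≡m (length α) (length β))) (cong (_∸ length β) sizes)
    reduced : All (_< n ∸ length β) (unshift (length β) α)
    reduced = All.map⁺ (All.tabulate λ a∈α → ∸-monoˡ-< (All.lookup below-α a∈α) (All.lookup high a∈α))

module Blocks {n k : ℕ} {α β : List ℕ} (k≤n : k ≤ n) (pα : Perm (n ∸ k) α) (pβ : Perm k β) where

  left-range : ∀ {y} → y ∈ shift k α → k ≤ y × y < n
  left-range y∈ with x , x∈α , refl ← ∈-shift⁻ k y∈ =
    m≤n+m k x , subst (x + k <_) (m∸n+n≡m k≤n) (+-monoˡ-< k (All.lookup (bounded pα) x∈α))

  below-left : All (_< n) (shift k α)
  below-left = All.tabulate (proj₂ ∘ left-range)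

  below-right : All (_< n) β
  below-right = All.map (λ x<k → <-≤-trans x<k k≤n) (bounded pβ)

  right<left : ∀ {a b} → a ∈ shift k α → b ∈ β → b < a
  right<left a∈ b∈β = <-≤-trans (All.lookup (bounded pβ) b∈β) (proj₁ (left-range a∈))

  sizes : length α + length β ≡ n
  sizes = trans (cong₂ _+_ (length≡ pα) (length≡ pβ)) (m∸n+n≡m k≤n)

  joined : Perm (suc n) (shift k α ++ n ∷ β)
  joined = mkPerm
    (Unique.++⁺ (Unique.map⁺ (+-cancelʳ-≡ k _ _) (unique pα))
                (All.map (λ x<n → ≢-sym (<⇒≢ x<n)) below-right ∷ unique pβ)
                disjoint)
    (All.++⁺ (All.map m<n⇒m<1+n below-left) (≤-refl ∷ All.map m<n⇒m<1+n below-right))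
    (begin
      length (shift k α ++ n ∷ β)         ≡⟨ length-++ (shift k α) ⟩
      length (shift k α) + suc (length β) ≡⟨ +-suc (length (shift k α)) (length β) ⟩
      suc (length (shift k α) + length β) ≡⟨ cong (λ l → suc (l + length β)) (length-map _ α) ⟩
      suc (length α + length β)           ≡⟨ cong suc sizes ⟩
      suc n                               ∎)
    where
    open ≡-Reasoning
    disjoint : ∀ {v} → v ∈ shift k α × v ∈ n ∷ β → ⊥
    disjoint (v∈ , here refl) = <-irrefl refl (proj₂ (left-range v∈))
    disjoint (v∈ , there v∈β) = <⇒≱ (All.lookup (bounded pβ) v∈β) (proj₁ (left-range v∈))

-- Occurrences of patterns of length three

Rel₃ : Set₁
Rel₃ = ℕ → ℕ → ℕ → Set

record Pattern₃ : Set where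
  field
    word          : Vec (Fin 3) 3
    position      : Fin 3 → Fin 3
    word∘position : ∀ a → Vec.lookup word (position a) ≡ a
    position∘word : ∀ i → position (Vec.lookup word i) ≡ i

-- position inverts the pattern; (x, y, z) has its relative order iff the entries at the positions of
-- the values 0, 1, 2 increase.
Shape : Pattern₃ → Rel₃
Shape P x y z = w (position 0F) < w (position 1F) × w (position 1F) < w (position 2F)
  where
  open Pattern₃ P
  w = Vec.lookup (x ∷ y ∷ z ∷ [])

pat132 pat321 pat123 : Pattern₃
pat132 = record
  { word = p132
  ; position = λ { 0F → 0F ; 1F → 2F ; 2F → 1F }
  ; word∘position = λ { 0F → refl ; 1F → refl ; 2F → refl }
  ; position∘word = λ { 0F → refl ; 1F → refl ; 2F → refl }
  }
pat321 = record
  { word = p321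
  ; position = λ { 0F → 2F ; 1F → 1F ; 2F → 0F }
  ; word∘position = λ { 0F → refl ; 1F → refl ; 2F → refl }
  ; position∘word = λ { 0F → refl ; 1F → refl ; 2F → refl }
  }
pat123 = record
  { word = p123
  ; position = λ { 0F → 0F ; 1F → 1F ; 2F → 2F }
  ; word∘position = λ { 0F → refl ; 1F → refl ; 2F → refl }
  ; position∘word = λ { 0F → refl ; 1F → refl ; 2F → refl }
  }

R132 R321 R123 : Rel₃
R132 = Shape pat132
R321 = Shape pat321
R123 = Shape pat123

module _ (P : Pattern₃) (c : ℕ) {x y z : ℕ} where

  open Pattern₃ P
  private
    w w⁺ : Fin 3 → ℕ
    w = Vec.lookup (x ∷ y ∷ z ∷ [])
    w⁺ = Vec.lookup (x + c ∷ y + c ∷ z + c ∷ [])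

    w⁺≡ : ∀ j → w⁺ j ≡ w j + c
    w⁺≡ 0F = refl
    w⁺≡ 1F = refl
    w⁺≡ 2F = refl

    <-shift⁺ : ∀ i j → w i < w j → w⁺ i < w⁺ j
    <-shift⁺ i j lt = subst₂ _<_ (sym (w⁺≡ i)) (sym (w⁺≡ j)) (+-monoˡ-< c lt)

    <-shift⁻ : ∀ i j → w⁺ i < w⁺ j → w i < w j
    <-shift⁻ i j lt = +-cancelʳ-< c _ _ (subst₂ _<_ (w⁺≡ i) (w⁺≡ j) lt)

  shape-shift⁺ : Shape P x y z → Shape P (x + c) (y + c) (z + c)
  shape-shift⁺ (lt₁ , lt₂) = <-shift⁺ (position 0F) (position 1F) lt₁ , <-shift⁺ (position 1F) (position 2F) lt₂

  shape-shift⁻ : Shape P (x + c) (y + c) (z + c) → Shape P x y z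
  shape-shift⁻ (lt₁ , lt₂) = <-shift⁻ (position 0F) (position 1F) lt₁ , <-shift⁻ (position 1F) (position 2F) lt₂

Occurs : Rel₃ → List ℕ → Set
Occurs R xs = ∃[ x ] ∃[ y ] ∃[ z ] (x ∷ y ∷ z ∷ []) ⊑ xs × R x y z

StartsWith : Rel₃ → List ℕ → Set
StartsWith R (x ∷ y ∷ z ∷ _) = R x y z
StartsWith R _ = ⊥

OccursConsecutively : Rel₃ → List ℕ → Set
OccursConsecutively R [] = ⊥
OccursConsecutively R (x ∷ xs) = StartsWith R (x ∷ xs) ⊎ OccursConsecutively R xs

StartsWithDescent : List ℕ → Set
StartsWithDescent (x ∷ y ∷ _) = y < x
StartsWithDescent _ = ⊥

EndsWithAscent : List ℕ → Set
EndsWithAscent (x ∷ y ∷ []) = x < y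
EndsWithAscent (x ∷ y ∷ z ∷ xs) = EndsWithAscent (y ∷ z ∷ xs)
EndsWithAscent _ = ⊥

occurs-mono : ∀ {R s xs} → s ⊑ xs → Occurs R s → Occurs R xs
occurs-mono s⊑xs (x , y , z , o , r) = x , y , z , ⊆-trans o s⊑xs , r

⊑-++⁻ : ∀ as {bs s : List ℕ} → s ⊑ as ++ bs → ∃[ s₁ ] ∃[ s₂ ] s ≡ s₁ ++ s₂ × s₁ ⊑ as × s₂ ⊑ bs
⊑-++⁻ [] s⊑ = [] , _ , refl , [] , s⊑
⊑-++⁻ (a ∷ as) (_ ∷ʳ s⊑) with s₁ , s₂ , refl , p₁ , p₂ ← ⊑-++⁻ as s⊑ = s₁ , s₂ , refl , a ∷ʳ p₁ , p₂
⊑-++⁻ (a ∷ as) (refl ∷ s⊑) with s₁ , s₂ , refl , p₁ , p₂ ← ⊑-++⁻ as s⊑ = a ∷ s₁ , s₂ , refl , refl ∷ p₁ , p₂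

⊑-map⁻ : ∀ (f : ℕ → ℕ) xs {s} → s ⊑ map f xs → ∃[ s′ ] s ≡ map f s′ × s′ ⊑ xs
⊑-map⁻ f [] [] = [] , refl , []
⊑-map⁻ f (x ∷ xs) (_ ∷ʳ s⊑) with s′ , refl , p ← ⊑-map⁻ f xs s⊑ = s′ , refl , x ∷ʳ p
⊑-map⁻ f (x ∷ xs) (refl ∷ s⊑) with s′ , refl , p ← ⊑-map⁻ f xs s⊑ = x ∷ s′ , refl , refl ∷ p

occurs-shift⁺ : ∀ P c {xs} → Occurs (Shape P) xs → Occurs (Shape P) (shift c xs)
occurs-shift⁺ P c (x , y , z , o , r) = x + c , y + c , z + c , Sublist.map⁺ (_+ c) o , shape-shift⁺ P c r

occurs-shift⁻ : ∀ P c xs → Occurs (Shape P) (shift c xs) → Occurs (Shape P) xs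
occurs-shift⁻ P c xs (_ , _ , _ , o , r) with x ∷ y ∷ z ∷ [] , refl , o′ ← ⊑-map⁻ (_+ c) xs o =
  x , y , z , o′ , shape-shift⁻ P c r

occursConsecutively-shift⁺ : ∀ P c xs → OccursConsecutively (Shape P) xs → OccursConsecutively (Shape P) (shift c xs)
occursConsecutively-shift⁺ P c (x ∷ y ∷ z ∷ xs) (inj₁ r) = inj₁ (shape-shift⁺ P c r)
occursConsecutively-shift⁺ P c (x ∷ xs) (inj₂ o) = inj₂ (occursConsecutively-shift⁺ P c xs o)

occursConsecutively-shift⁻ : ∀ P c xs → OccursConsecutively (Shape P) (shift c xs) → OccursConsecutively (Shape P) xs
occursConsecutively-shift⁻ P c (x ∷ y ∷ z ∷ xs) (inj₁ r) = inj₁ (shape-shift⁻ P c r)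
occursConsecutively-shift⁻ P c (x ∷ xs) (inj₂ o) = inj₂ (occursConsecutively-shift⁻ P c xs o)

startsWithDescent-shift⁻ : ∀ c xs → StartsWithDescent (shift c xs) → StartsWithDescent xs
startsWithDescent-shift⁻ c (x ∷ y ∷ xs) = +-cancelʳ-< c y x

startsWithDescent-shift⁺ : ∀ c xs → StartsWithDescent xs → StartsWithDescent (shift c xs)
startsWithDescent-shift⁺ c (x ∷ y ∷ xs) = +-monoˡ-< c

endsWithAscent-shift⁻ : ∀ c xs → EndsWithAscent (shift c xs) → EndsWithAscent xs
endsWithAscent-shift⁻ c (x ∷ y ∷ []) = +-cancelʳ-< c x y
endsWithAscent-shift⁻ c (x ∷ y ∷ z ∷ xs) = endsWithAscent-shift⁻ c (y ∷ z ∷ xs)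

endsWithAscent-shift⁺ : ∀ c xs → EndsWithAscent xs → EndsWithAscent (shift c xs)
endsWithAscent-shift⁺ c (x ∷ y ∷ []) = +-monoˡ-< c
endsWithAscent-shift⁺ c (x ∷ y ∷ z ∷ xs) = endsWithAscent-shift⁺ c (y ∷ z ∷ xs)

occursConsecutively-++⁺ˡ : ∀ {R} xs ys → OccursConsecutively R xs → OccursConsecutively R (xs ++ ys)
occursConsecutively-++⁺ˡ (x ∷ y ∷ z ∷ xs) ys (inj₁ r) = inj₁ r
occursConsecutively-++⁺ˡ (x ∷ xs) ys (inj₂ o) = inj₂ (occursConsecutively-++⁺ˡ xs ys o)

occursConsecutively-++⁺ʳ : ∀ {R} xs {ys} → OccursConsecutively R ys → OccursConsecutively R (xs ++ ys)
occursConsecutively-++⁺ʳ [] o = o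
occursConsecutively-++⁺ʳ (x ∷ xs) o = inj₂ (occursConsecutively-++⁺ʳ xs o)

module _ {m : ℕ} where

  -- a < b would make (a, m, b) an occurrence of 132.
  avoids132⇒left-above-right : ∀ α {β} → Unique (α ++ m ∷ β) → All (_< m) β →
    ¬ Occurs R132 (α ++ m ∷ β) → ∀ {a b} → a ∈ α → b ∈ β → b < a
  avoids132⇒left-above-right α u below-β no132 {a} {b} a∈α b∈β with <-cmp a b
  ... | tri> _ _ b<a = b<a
  ... | tri≈ _ refl _ = contradiction (there b∈β) (unique-++⇒disjoint α u a∈α)
  ... | tri< a<b _ _ = contradiction
    (a , m , b , Sublist.++⁺ (from∈ a∈α) (refl ∷ from∈ b∈β) , a<b , All.lookup below-β b∈β) no132

  occurs132-around-max : ∀ α {β} → All (_< m) α → All (_< m) β → (∀ {a b} → a ∈ α → b ∈ β → b < a) →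
    Occurs R132 (α ++ m ∷ β) → Occurs R132 α ⊎ Occurs R132 β
  occurs132-around-max α below-α below-β β<α (x , y , z , o , x<z , z<y) with ⊑-++⁻ α o
  ... | [] , _ , refl , _ , _ ∷ʳ o₂ = inj₂ (x , y , z , o₂ , x<z , z<y)
  ... | [] , _ , refl , _ , refl ∷ o₂ = ⊥-elim (<-asym x<z (All.lookup below-β (⊑-lookup o₂ (there (here refl)))))
  ... | _ ∷ [] , _ , refl , o₁ , o₂ = ⊥-elim (<-asym x<z (β<α (⊑-lookup o₁ (here refl)) (second∈tail o₂)))
    where
    second∈tail : ∀ {β} → (y ∷ z ∷ []) ⊑ m ∷ β → z ∈ β
    second∈tail (_ ∷ʳ o) = ⊑-lookup o (there (here refl))
    second∈tail (refl ∷ o) = ⊑-lookup o (here refl)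
  ... | _ ∷ _ ∷ [] , _ , refl , o₁ , _ ∷ʳ o₂ =
    ⊥-elim (<-asym x<z (β<α (⊑-lookup o₁ (here refl)) (⊑-lookup o₂ (here refl))))
  ... | _ ∷ _ ∷ [] , _ , refl , o₁ , refl ∷ _ =
    ⊥-elim (<-asym z<y (All.lookup below-α (⊑-lookup o₁ (there (here refl)))))
  ... | _ ∷ _ ∷ _ ∷ [] , [] , refl , o₁ , _ = inj₁ (x , y , z , o₁ , x<z , z<y)

  occurs321-around-max⁻ : ∀ α {β} → All (_< m) α → All (_< m) β → OccursConsecutively R321 (α ++ m ∷ β) →
    OccursConsecutively R321 α ⊎ StartsWithDescent β ⊎ OccursConsecutively R321 β
  occurs321-around-max⁻ [] {_ ∷ _ ∷ _} _ _ (inj₁ (c<b , _)) = inj₂ (inj₁ c<b)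
  occurs321-around-max⁻ [] _ _ (inj₂ o) = inj₂ (inj₂ o)
  occurs321-around-max⁻ (a ∷ []) {_ ∷ _} (a<m ∷ _) _ (inj₁ (_ , m<a)) = ⊥-elim (<-asym m<a a<m)
  occurs321-around-max⁻ (a ∷ b ∷ []) (_ ∷ b<m ∷ _) _ (inj₁ (m<b , _)) = ⊥-elim (<-asym m<b b<m)
  occurs321-around-max⁻ (a ∷ b ∷ c ∷ α) _ _ (inj₁ r) = inj₁ (inj₁ r)
  occurs321-around-max⁻ (a ∷ α) (_ ∷ below-α) below-β (inj₂ o) with occurs321-around-max⁻ α below-α below-β o
  ... | inj₁ o′ = inj₁ (inj₂ o′)
  ... | inj₂ o′ = inj₂ o′

  occurs321-around-max⁺ : ∀ α {β} → All (_< m) β →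
    OccursConsecutively R321 α ⊎ StartsWithDescent β ⊎ OccursConsecutively R321 β →
    OccursConsecutively R321 (α ++ m ∷ β)
  occurs321-around-max⁺ α _ (inj₁ o) = occursConsecutively-++⁺ˡ α _ o
  occurs321-around-max⁺ α {_ ∷ _ ∷ _} (b<m ∷ _) (inj₂ (inj₁ c<b)) = occursConsecutively-++⁺ʳ α (inj₁ (c<b , b<m))
  occurs321-around-max⁺ α _ (inj₂ (inj₂ o)) = occursConsecutively-++⁺ʳ α (inj₂ o)

  occurs123-around-max⁻ : ∀ α {β} → All (_< m) α → All (_< m) β → OccursConsecutively R123 (α ++ m ∷ β) →
    OccursConsecutively R123 α ⊎ EndsWithAscent α ⊎ OccursConsecutively R123 β
  occurs123-around-max⁻ [] {_ ∷ _ ∷ _} _ (b<m ∷ _) (inj₁ (m<b , _)) = ⊥-elim (<-asym m<b b<m)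
  occurs123-around-max⁻ [] _ _ (inj₂ o) = inj₂ (inj₂ o)
  occurs123-around-max⁻ (a ∷ []) {_ ∷ _} _ (b<m ∷ _) (inj₁ (_ , m<b)) = ⊥-elim (<-asym m<b b<m)
  occurs123-around-max⁻ (a ∷ b ∷ []) _ _ (inj₁ (a<b , _)) = inj₂ (inj₁ a<b)
  occurs123-around-max⁻ (a ∷ b ∷ c ∷ α) _ _ (inj₁ r) = inj₁ (inj₁ r)
  occurs123-around-max⁻ (a ∷ α) (_ ∷ below-α) below-β (inj₂ o) with occurs123-around-max⁻ α below-α below-β o
  ... | inj₁ o′ = inj₁ (inj₂ o′)
  ... | inj₂ (inj₁ ascent) = inj₂ (inj₁ (endsWithAscent-∷ α ascent))
    where
    endsWithAscent-∷ : ∀ xs → EndsWithAscent xs → EndsWithAscent (a ∷ xs)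
    endsWithAscent-∷ (_ ∷ _ ∷ _) ascent = ascent
  ... | inj₂ (inj₂ o′) = inj₂ (inj₂ o′)

  occurs123-around-max⁺ : ∀ α {β} → All (_< m) α →
    OccursConsecutively R123 α ⊎ EndsWithAscent α ⊎ OccursConsecutively R123 β →
    OccursConsecutively R123 (α ++ m ∷ β)
  occurs123-around-max⁺ α _ (inj₁ o) = occursConsecutively-++⁺ˡ α _ o
  occurs123-around-max⁺ (a ∷ b ∷ []) (_ ∷ b<m ∷ _) (inj₂ (inj₁ a<b)) = inj₁ (a<b , b<m)
  occurs123-around-max⁺ (a ∷ b ∷ c ∷ α) (_ ∷ below-α) (inj₂ (inj₁ ascent)) =
    inj₂ (occurs123-around-max⁺ (b ∷ c ∷ α) below-α (inj₂ (inj₁ ascent)))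
  occurs123-around-max⁺ α _ (inj₂ (inj₂ o)) = occursConsecutively-++⁺ʳ α (inj₂ o)

  startsWithDescent-++ : ∀ α {β} → StartsWithDescent α → StartsWithDescent (α ++ m ∷ β)
  startsWithDescent-++ (_ ∷ _ ∷ _) descent = descent

  startsWithDescent-max : ∀ {β} → β ≢ [] → All (_< m) β → StartsWithDescent (m ∷ β)
  startsWithDescent-max {[]} β≢[] _ = contradiction refl β≢[]
  startsWithDescent-max {_ ∷ _} _ (b<m ∷ _) = b<m

  startsWithDescent-++⁻ : ∀ α {β} → α ≢ [] → All (_< m) α → StartsWithDescent (α ++ m ∷ β) → StartsWithDescent α
  startsWithDescent-++⁻ [] α≢[] _ _ = contradiction refl α≢[]
  startsWithDescent-++⁻ (a ∷ []) _ (a<m ∷ _) m<a = ⊥-elim (<-asym m<a a<m)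
  startsWithDescent-++⁻ (_ ∷ _ ∷ _) _ _ descent = descent

  endsWithAscent-++ : ∀ α {β} → EndsWithAscent β → EndsWithAscent (α ++ m ∷ β)
  endsWithAscent-++ [] {_ ∷ _ ∷ _} ascent = ascent
  endsWithAscent-++ (a ∷ α) {β} ascent = endsWithAscent-∷ (α ++ m ∷ β) (endsWithAscent-++ α ascent)
    where
    endsWithAscent-∷ : ∀ xs → EndsWithAscent xs → EndsWithAscent (a ∷ xs)
    endsWithAscent-∷ (_ ∷ _ ∷ _) ascent = ascent

  endsWithAscent-max : ∀ α → α ≢ [] → All (_< m) α → EndsWithAscent (α ++ m ∷ [])
  endsWithAscent-max [] α≢[] _ = contradiction refl α≢[]
  endsWithAscent-max (a ∷ []) _ (a<m ∷ _) = a<m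
  endsWithAscent-max (a ∷ b ∷ []) _ (_ ∷ b<m ∷ _) = b<m
  endsWithAscent-max (a ∷ b ∷ c ∷ α) _ (_ ∷ below-α) = endsWithAscent-max (b ∷ c ∷ α) (λ ()) below-α

  endsWithAscent-++⁻ : ∀ α {β} → β ≢ [] → All (_< m) β → EndsWithAscent (α ++ m ∷ β) → EndsWithAscent β
  endsWithAscent-++⁻ [] {[]} β≢[] _ _ = contradiction refl β≢[]
  endsWithAscent-++⁻ [] {_ ∷ []} _ (b<m ∷ _) m<b = ⊥-elim (<-asym m<b b<m)
  endsWithAscent-++⁻ [] {_ ∷ _ ∷ _} _ _ ascent = ascent
  endsWithAscent-++⁻ (a ∷ []) {[]} β≢[] _ _ = contradiction refl β≢[]
  endsWithAscent-++⁻ (a ∷ []) {_ ∷ β} β≢[] below-β ascent = endsWithAscent-++⁻ [] β≢[] below-β ascent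
  endsWithAscent-++⁻ (a ∷ b ∷ []) β≢[] below-β ascent = endsWithAscent-++⁻ (b ∷ []) β≢[] below-β ascent
  endsWithAscent-++⁻ (a ∷ b ∷ c ∷ α) β≢[] below-β ascent = endsWithAscent-++⁻ (b ∷ c ∷ α) β≢[] below-β ascent

-- Decomposition at the maximum

Perms : (List ℕ → Set) → ℕ → Set
Perms P m = Refinement (List ℕ) λ xs → Perm m xs × P xs

Convolution : (ℕ → Set) → (ℕ → Set) → ℕ → Set
Convolution F G n = Σ (Fin (suc n)) λ k → F (toℕ k) × G (n ∸ toℕ k)

FirstSplit : ℕ → List ℕ → Set
FirstSplit m xs = ∃[ α ] ∃[ β ] xs ≡ α ++ m ∷ β × m ∉ α

-- The membership proof is taken irrelevantly, so that the irrelevant proofs inside Perms can supply it.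
first-split : (m : ℕ) (xs : List ℕ) → .(m ∈ xs) → FirstSplit m xs
first-split m (x ∷ xs) m∈ with x ≟ m
... | yes refl = [] , xs , refl , λ ()
... | no x≢m with α , β , refl , m∉α ← first-split m xs (Any.tail (x≢m ∘ sym) m∈) =
  x ∷ α , β , refl , λ { (here m≡x) → x≢m (sym m≡x) ; (there m∈α) → m∉α m∈α }

first-split-unique : ∀ {m : ℕ} α₁ β₁ α₂ β₂ → α₁ ++ m ∷ β₁ ≡ α₂ ++ m ∷ β₂ → m ∉ α₁ → m ∉ α₂ → α₁ ≡ α₂ × β₁ ≡ β₂
first-split-unique [] _ [] _ refl _ _ = refl , refl
first-split-unique [] _ (_ ∷ _) _ refl _ m∉α₂ = contradiction (here refl) m∉α₂
first-split-unique (_ ∷ _) _ [] _ refl m∉α₁ _ = contradiction (here refl) m∉α₁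
first-split-unique (x ∷ α₁) β₁ (y ∷ α₂) β₂ eq m∉α₁ m∉α₂
  with refl , eq′ ← ∷-injective eq
  with refl , refl ← first-split-unique α₁ β₁ α₂ β₂ eq′ (m∉α₁ ∘ there) (m∉α₂ ∘ there) = refl , refl

recompute-≡ : {xs ys : List ℕ} → .(xs ≡ ys) → xs ≡ ys
recompute-≡ {xs} {ys} = recompute (List.≡-dec _≟_ xs ys)

-- A permutation α n β of [0, n] with α above β is determined by k = |β|, the permutation β of [0, k)
-- and the permutation α - k of [0, n - k).
module DecomposeAtMax (P Pleft Pright : List ℕ → Set) (n : ℕ)
  (left-above-right : ∀ α β → Perm (suc n) (α ++ n ∷ β) → P (α ++ n ∷ β) →
                      ∀ {a b} → a ∈ α → b ∈ β → b < a)
  (split : ∀ {k α β} → k ≤ n → Perm (n ∸ k) α → Perm k β →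
           P (shift k α ++ n ∷ β) → Pleft α × Pright β)
  (join : ∀ {k α β} → k ≤ n → Perm (n ∸ k) α → Perm k β →
          Pleft α → Pright β → P (shift k α ++ n ∷ β))
  where

  private
    Pieces = Convolution (Perms Pright) (Perms Pleft) n

    pieces-≡ : ∀ {k k′ β β′ α α′ p q r s} → k ≡ k′ → β ≡ β′ → α ≡ α′ →
               _≡_ {A = Pieces} (k , (β , p) , (α , q)) (k′ , (β′ , r) , (α′ , s))
    pieces-≡ refl refl refl = refl

    cut-index : ∀ α β → .(Perm (suc n) (α ++ n ∷ β)) → Fin (suc n)
    cut-index α β p = fromℕ< (s≤s (subst (length β ≤_) (AroundMax.sizes α β p) (m≤n+m (length β) (length α))))

    module Cut (α β : List ℕ) (pr : Perm (suc n) (α ++ n ∷ β) × P (α ++ n ∷ β)) where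
      k = toℕ (cut-index α β (proj₁ pr))

      blocks : Perm (n ∸ k) (unshift k α) × Perm k β × shift k (unshift k α) ≡ α
      blocks = AroundMax.split-above α β (proj₁ pr) (toℕ-fromℕ< _)
                 (left-above-right α β (proj₁ pr) (proj₂ pr))

      classes : Pleft (unshift k α) × Pright β
      classes = split (m<1+n⇒m≤n (toℕ<n (cut-index α β (proj₁ pr)))) (proj₁ blocks) (proj₁ (proj₂ blocks))
                  (subst (λ γ → P (γ ++ n ∷ β)) (sym (proj₂ (proj₂ blocks))) (proj₂ pr))

      left : Perm (n ∸ k) (unshift k α) × Pleft (unshift k α)
      left = proj₁ blocks , proj₁ classes

      right : Perm k β × Pright β
      right = proj₁ (proj₂ blocks) , proj₂ classes

    cut : (π : List ℕ) → .(Perm (suc n) π × P π) → FirstSplit n π → Pieces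
    cut π pr (α , β , π≡ , _) =
      k , (β , [ Cut.right α β (subst Class π≡ pr) ]) , (unshift (toℕ k) α , [ Cut.left α β (subst Class π≡ pr) ])
      where
      Class = λ γ → Perm (suc n) γ × P γ
      k = cut-index α β (proj₁ (subst Class π≡ pr))

    to : Perms P (suc n) → Pieces
    to (π , [ pr ]) = cut π pr (first-split n π (perm⇒∈ (proj₁ pr) ≤-refl))

    from : Pieces → Perms P (suc n)
    from (k , (β , [ r ]) , (α , [ l ])) =
      shift (toℕ k) α ++ n ∷ β ,
      [ Blocks.joined k≤n (proj₁ l) (proj₁ r) , join k≤n (proj₁ l) (proj₁ r) (proj₂ l) (proj₂ r) ]
      where k≤n = m<1+n⇒m≤n (toℕ<n k)

    to∘from : ∀ y → to (from y) ≡ y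
    to∘from (k , (β , [ r ]) , (α , [ l ])) =
      recut {Blocks.joined k≤n (proj₁ l) (proj₁ r) , join k≤n (proj₁ l) (proj₁ r) (proj₂ l) (proj₂ r)}
            (first-split n _ (perm⇒∈ (Blocks.joined k≤n (proj₁ l) (proj₁ r)) ≤-refl))
      where
      k≤n = m<1+n⇒m≤n (toℕ<n k)
      recut : ∀ .{pr} (s : FirstSplit n (shift (toℕ k) α ++ n ∷ β)) → cut _ pr s ≡ (k , (β , [ r ]) , (α , [ l ]))
      recut {pr} (α₁ , β₁ , eq , n∉α₁) = pieces-≡ k-same β₁≡β α-same
        where
        n∉left : n ∉ shift (toℕ k) α
        n∉left n∈ = ⊥-elim-irr (<-irrefl refl (All.lookup (Blocks.below-left k≤n (proj₁ l) (proj₁ r)) n∈))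
        same = first-split-unique α₁ β₁ (shift (toℕ k) α) β (sym eq) n∉α₁ n∉left
        β₁≡β = proj₂ same
        k-same : cut-index α₁ β₁ (subst (Perm (suc n)) eq (proj₁ pr)) ≡ k
        k-same = toℕ-injective
          (trans (toℕ-fromℕ< _) (trans (cong length β₁≡β) (recompute (_ ≟ _) (length≡ (proj₁ r)))))
        α-same : unshift (toℕ (cut-index α₁ β₁ (subst (Perm (suc n)) eq (proj₁ pr)))) α₁ ≡ α
        α-same = trans (cong₂ unshift (cong toℕ k-same) (proj₁ same)) (unshift-shift (toℕ k) α)

    from∘to : ∀ x → from (to x) ≡ x
    from∘to (π , [ pr ]) = uncut (first-split n π (perm⇒∈ (proj₁ pr) ≤-refl))
      where
      uncut : (s : FirstSplit n π) → from (cut π pr s) ≡ (π , [ pr ])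
      uncut (α , β , π≡ , _) = value-injective (recompute-≡ (trans
        (cong (_++ n ∷ β) (proj₂ (proj₂ (Cut.blocks α β (subst (λ γ → Perm (suc n) γ × P γ) π≡ pr)))))
        (sym π≡)))

  decompose : Perms P (suc n) ↔ Convolution (Perms Pright) (Perms Pleft) n
  decompose = mk↔ₛ′ to from to∘from from∘to

Avoids : Rel₃ → Rel₃ → List ℕ → Set
Avoids R S xs = ¬ Occurs R xs × ¬ OccursConsecutively S xs

NonEmpty : (List ℕ → Set) → List ℕ → Set
NonEmpty P xs = P xs × xs ≢ []

-- Right of the maximum n, a block of class A may not start with a descent (n b c with c < b is a 321);
-- left of it, a block of class C may not end with an ascent (a b n with a < b is a 123).
ClassA ClassA′ ClassC ClassC′ : List ℕ → Set
ClassA = Avoids R132 R321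
ClassA′ xs = ClassA xs × ¬ StartsWithDescent xs
ClassC = Avoids R132 R123
ClassC′ xs = ClassC xs × ¬ EndsWithAscent xs

length≡suc⇒≢[] : ∀ {xs : List ℕ} {m} → length xs ≡ suc m → xs ≢ []
length≡suc⇒≢[] {_ ∷ _} _ ()

shift-≢[] : ∀ c {xs} → xs ≢ [] → shift c xs ≢ []
shift-≢[] c {[]} xs≢[] = contradiction refl xs≢[]
shift-≢[] c {_ ∷ _} _ ()

⊑-left : ∀ α {m : ℕ} {β} → α ⊑ α ++ m ∷ β
⊑-left α = Sublist.++⁺ʳ _ ⊆-refl

⊑-right : ∀ α {m : ℕ} {β} → β ⊑ α ++ m ∷ β
⊑-right α {m} = Sublist.++⁺ˡ α (m ∷ʳ ⊆-refl)

avoids132⇒above : ∀ {n} α β → Perm (suc n) (α ++ n ∷ β) → ¬ Occurs R132 (α ++ n ∷ β) →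
                  ∀ {a b} → a ∈ α → b ∈ β → b < a
avoids132⇒above α β p = avoids132⇒left-above-right α (unique p) (AroundMax.below-β α β p)

module _ {n k : ℕ} {α β : List ℕ} (k≤n : k ≤ n) (pα : Perm (n ∸ k) α) (pβ : Perm k β) where

  open Blocks k≤n pα pβ

  private
    whole = shift k α ++ n ∷ β

  avoids132-split : ¬ Occurs R132 whole → ¬ Occurs R132 α × ¬ Occurs R132 β
  avoids132-split no132 = no132 ∘ occurs-mono (⊑-left (shift k α)) ∘ occurs-shift⁺ pat132 k
                        , no132 ∘ occurs-mono (⊑-right (shift k α))

  avoids132-join : ¬ Occurs R132 α → ¬ Occurs R132 β → ¬ Occurs R132 whole
  avoids132-join ¬α ¬β o with occurs132-around-max (shift k α) below-left below-right right<left o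
  ... | inj₁ oα = ¬α (occurs-shift⁻ pat132 k α oα)
  ... | inj₂ oβ = ¬β oβ

  avoids321-split : ¬ OccursConsecutively R321 whole →
    ¬ OccursConsecutively R321 α × ¬ OccursConsecutively R321 β × ¬ StartsWithDescent β
  avoids321-split no321 =
      no321 ∘ occurs321-around-max⁺ (shift k α) below-right ∘ inj₁ ∘ occursConsecutively-shift⁺ pat321 k α
    , no321 ∘ occurs321-around-max⁺ (shift k α) below-right ∘ inj₂ ∘ inj₂
    , no321 ∘ occurs321-around-max⁺ (shift k α) below-right ∘ inj₂ ∘ inj₁

  avoids321-join : ¬ OccursConsecutively R321 α → ¬ OccursConsecutively R321 β → ¬ StartsWithDescent β →
    ¬ OccursConsecutively R321 whole
  avoids321-join ¬α ¬β ¬descent o with occurs321-around-max⁻ (shift k α) below-left below-right o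
  ... | inj₁ oα = ¬α (occursConsecutively-shift⁻ pat321 k α oα)
  ... | inj₂ (inj₁ descent) = ¬descent descent
  ... | inj₂ (inj₂ oβ) = ¬β oβ

  avoids123-split : ¬ OccursConsecutively R123 whole →
    ¬ OccursConsecutively R123 α × ¬ EndsWithAscent α × ¬ OccursConsecutively R123 β
  avoids123-split no123 =
      no123 ∘ occurs123-around-max⁺ (shift k α) below-left ∘ inj₁ ∘ occursConsecutively-shift⁺ pat123 k α
    , no123 ∘ occurs123-around-max⁺ (shift k α) below-left ∘ inj₂ ∘ inj₁ ∘ endsWithAscent-shift⁺ k α
    , no123 ∘ occurs123-around-max⁺ (shift k α) below-left ∘ inj₂ ∘ inj₂

  avoids123-join : ¬ OccursConsecutively R123 α → ¬ EndsWithAscent α → ¬ OccursConsecutively R123 β →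
    ¬ OccursConsecutively R123 whole
  avoids123-join ¬α ¬ascent ¬β o with occurs123-around-max⁻ (shift k α) below-left below-right o
  ... | inj₁ oα = ¬α (occursConsecutively-shift⁻ pat123 k α oα)
  ... | inj₂ (inj₁ ascent) = ¬ascent (endsWithAscent-shift⁻ k α ascent)
  ... | inj₂ (inj₂ oβ) = ¬β oβ

  classA-split : ClassA whole → ClassA α × ClassA′ β
  classA-split (no132 , no321) with ¬α , ¬β ← avoids132-split no132
                               with ¬α′ , ¬β′ , ¬descent ← avoids321-split no321 =
    (¬α , ¬α′) , (¬β , ¬β′) , ¬descent

  classA-join : ClassA α → ClassA′ β → ClassA whole
  classA-join (¬α , ¬α′) ((¬β , ¬β′) , ¬descent) = avoids132-join ¬α ¬β , avoids321-join ¬α′ ¬β′ ¬descent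

  classC-split : ClassC whole → ClassC′ α × ClassC β
  classC-split (no132 , no123) with ¬α , ¬β ← avoids132-split no132
                               with ¬α′ , ¬ascent , ¬β′ ← avoids123-split no123 =
    ((¬α , ¬α′) , ¬ascent) , (¬β , ¬β′)

  classC-join : ClassC′ α → ClassC β → ClassC whole
  classC-join ((¬α , ¬α′) , ¬ascent) (¬β , ¬β′) = avoids132-join ¬α ¬β , avoids123-join ¬α′ ¬ascent ¬β′

  blocks-nonempty : 0 < n → α ≡ [] → β ≢ []
  blocks-nonempty 0<n α≡[] β≡[] =
    <-irrefl (trans (sym (cong₂ (λ a b → length a + length b) α≡[] β≡[])) sizes) 0<n

  classA′-split : 0 < n → ClassA′ whole → NonEmpty ClassA′ α × ClassA′ β
  classA′-split 0<n (cwhole , ¬descent) with cα , cβ ← classA-split cwhole =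
    ((cα , ¬descent ∘ startsWithDescent-++ (shift k α) ∘ startsWithDescent-shift⁺ k α) , α≢[]) , cβ
    where
    α≢[] : α ≢ []
    α≢[] α≡[] = ¬descent (subst (λ γ → StartsWithDescent (shift k γ ++ n ∷ β)) (sym α≡[])
                                (startsWithDescent-max (blocks-nonempty 0<n α≡[]) below-right))

  classA′-join : NonEmpty ClassA′ α → ClassA′ β → ClassA′ whole
  classA′-join ((cα , ¬descent) , α≢[]) cβ = classA-join cα cβ ,
    ¬descent ∘ startsWithDescent-shift⁻ k α ∘ startsWithDescent-++⁻ (shift k α) (shift-≢[] k α≢[]) below-left

  classC′-split : 0 < n → ClassC′ whole → ClassC′ α × NonEmpty ClassC′ β
  classC′-split 0<n (cwhole , ¬ascent) with cα , cβ ← classC-split cwhole =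
    cα , ((cβ , ¬ascent ∘ endsWithAscent-++ (shift k α)) , β≢[])
    where
    β≢[] : β ≢ []
    β≢[] β≡[] = ¬ascent (subst (λ γ → EndsWithAscent (shift k α ++ n ∷ γ)) (sym β≡[])
                               (endsWithAscent-max (shift k α) (shift-≢[] k α≢[]) below-left))
      where
      α≢[] : α ≢ []
      α≢[] α≡[] = blocks-nonempty 0<n α≡[] β≡[]

  classC′-join : ClassC′ α → NonEmpty ClassC′ β → ClassC′ whole
  classC′-join cα ((cβ , ¬ascent) , β≢[]) = classC-join cα cβ ,
    ¬ascent ∘ endsWithAscent-++⁻ (shift k α) β≢[] below-right

decomposeA : ∀ n → Perms ClassA (suc n) ↔ Convolution (Perms ClassA′) (Perms ClassA) n
decomposeA n = DecomposeAtMax.decompose ClassA ClassA ClassA′ n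
  (λ α β p → avoids132⇒above α β p ∘ proj₁) classA-split classA-join

decomposeA′ : ∀ n → Perms ClassA′ (suc (suc n)) ↔ Convolution (Perms ClassA′) (Perms (NonEmpty ClassA′)) (suc n)
decomposeA′ n = DecomposeAtMax.decompose ClassA′ (NonEmpty ClassA′) ClassA′ (suc n)
  (λ α β p → avoids132⇒above α β p ∘ proj₁ ∘ proj₁) (λ k≤n pα pβ → classA′-split k≤n pα pβ z<s) classA′-join

decomposeC : ∀ n → Perms ClassC (suc n) ↔ Convolution (Perms ClassC) (Perms ClassC′) n
decomposeC n = DecomposeAtMax.decompose ClassC ClassC′ ClassC n
  (λ α β p → avoids132⇒above α β p ∘ proj₁) classC-split classC-join

decomposeC′ : ∀ n → Perms ClassC′ (suc (suc n)) ↔ Convolution (Perms (NonEmpty ClassC′)) (Perms ClassC′) (suc n)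
decomposeC′ n = DecomposeAtMax.decompose ClassC′ ClassC′ (NonEmpty ClassC′) (suc n)
  (λ α β p → avoids132⇒above α β p ∘ proj₁ ∘ proj₁) (λ k≤n pα pβ → classC′-split k≤n pα pβ z<s) classC′-join

-- Counting

Σ≤ : ℕ → (ℕ → ℕ) → ℕ
Σ≤ N h = sum (applyUpTo h (suc N))

Σ≤-cong : ∀ N {h h′} → (∀ {k} → k ≤ N → h k ≡ h′ k) → Σ≤ N h ≡ Σ≤ N h′
Σ≤-cong zero eq = cong (_+ 0) (eq z≤n)
Σ≤-cong (suc N) eq = cong₂ _+_ (eq z≤n) (Σ≤-cong N (eq ∘ s≤s))

Σ≤-snoc : ∀ N h → Σ≤ (suc N) h ≡ Σ≤ N h + h (suc N)
Σ≤-snoc N h = begin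
  sum (applyUpTo h (suc (suc N)))              ≡⟨ cong sum (applyUpTo-∷ʳ h (suc N)) ⟨
  sum (applyUpTo h (suc N) ++ h (suc N) ∷ [])  ≡⟨ sum-++ (applyUpTo h (suc N)) (h (suc N) ∷ []) ⟩
  Σ≤ N h + (h (suc N) + 0)                     ≡⟨ cong (Σ≤ N h +_) (+-identityʳ (h (suc N))) ⟩
  Σ≤ N h + h (suc N)                           ∎
  where open ≡-Reasoning

Σ≤-reverse : ∀ N h → Σ≤ N h ≡ Σ≤ N (λ k → h (N ∸ k))
Σ≤-reverse zero h = refl
Σ≤-reverse (suc N) h = begin
  Σ≤ (suc N) h                       ≡⟨ Σ≤-snoc N h ⟩
  Σ≤ N h + h (suc N)                 ≡⟨ cong (_+ h (suc N)) (Σ≤-reverse N h) ⟩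
  Σ≤ N (λ k → h (N ∸ k)) + h (suc N) ≡⟨ +-comm _ (h (suc N)) ⟩
  Σ≤ (suc N) (λ k → h (suc N ∸ k))   ∎
  where open ≡-Reasoning

Σ-Fin-suc↔ : ∀ {n} (F : Fin (suc n) → Set) → Σ (Fin (suc n)) F ↔ (F Fin.zero ⊎ Σ (Fin n) (F ∘ Fin.suc))
Σ-Fin-suc↔ F = mk↔ₛ′
  (λ { (Fin.zero , x) → inj₁ x ; (Fin.suc i , x) → inj₂ (i , x) })
  (λ { (inj₁ x) → Fin.zero , x ; (inj₂ (i , x)) → Fin.suc i , x })
  (λ { (inj₁ x) → refl ; (inj₂ (i , x)) → refl })
  (λ { (Fin.zero , x) → refl ; (Fin.suc i , x) → refl })

Σ-Fin↔Fin-sum : ∀ n (F : ℕ → Set) (h : ℕ → ℕ) → (∀ {k} → k < n → F k ↔ Fin (h k)) →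
  Σ (Fin n) (F ∘ toℕ) ↔ Fin (sum (applyUpTo h n))
Σ-Fin↔Fin-sum zero F h _ = mk↔ₛ′ (λ ()) (λ ()) (λ ()) (λ ())
Σ-Fin↔Fin-sum (suc n) F h count = ↔-trans (Σ-Fin-suc↔ (F ∘ toℕ))
  (↔-trans (count z<s ⊎-↔ Σ-Fin↔Fin-sum n (F ∘ suc) (h ∘ suc) (count ∘ s≤s)) (↔-sym +↔⊎))

convolution↔Fin : ∀ N (F G : ℕ → Set) (f g : ℕ → ℕ) →
  (∀ {k} → k ≤ N → F k ↔ Fin (f k)) → (∀ {k} → k ≤ N → G k ↔ Fin (g k)) →
  Convolution F G N ↔ Fin (Σ≤ N (λ k → f k * g (N ∸ k)))
convolution↔Fin N F G f g countF countG = Σ-Fin↔Fin-sum (suc N) _ _ λ {k} k<1+N →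
  ↔-trans (countF (m<1+n⇒m≤n k<1+N) ×-↔ countG (m∸n≤m N k)) (↔-sym *↔×)

avoids-[] : ∀ R S → Avoids R S []
avoids-[] R S = (λ { (_ , _ , _ , () , _) }) , λ ()

avoids-singleton : ∀ R S x → Avoids R S (x ∷ [])
avoids-singleton R S x = (λ { (_ , _ , _ , _ ∷ʳ () , _) ; (_ , _ , _ , refl ∷ () , _) }) , λ { (inj₁ ()) ; (inj₂ ()) }

perm-0 : ∀ {xs} → Perm 0 xs → xs ≡ []
perm-0 {[]} _ = refl

perm-1 : ∀ {xs} → Perm 1 xs → xs ≡ 0 ∷ []
perm-1 {x ∷ []} (mkPerm _ (s≤s z≤n ∷ []) _) = refl

Perms-0↔ : ∀ {Q} → Q [] → Perms Q 0 ↔ Fin 1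
Perms-0↔ q = mk↔ₛ′ (λ _ → Fin.zero) (λ _ → [] , [ mkPerm [] [] refl , q ]) (λ { Fin.zero → refl ; (Fin.suc ()) })
  (λ { (_ , [ p ]) → value-injective (recompute-≡ (sym (perm-0 (proj₁ p)))) })

Perms-1↔ : ∀ {Q} → Q (0 ∷ []) → Perms Q 1 ↔ Fin 1
Perms-1↔ q = mk↔ₛ′ (λ _ → Fin.zero) (λ _ → 0 ∷ [] , [ mkPerm ([] ∷ []) (z<s ∷ []) refl , q ])
  (λ { Fin.zero → refl ; (Fin.suc ()) })
  (λ { (_ , [ p ]) → value-injective (recompute-≡ (sym (perm-1 (proj₁ p)))) })

Perms-NonEmpty-0↔ : ∀ {Q} → Perms (NonEmpty Q) 0 ↔ Fin 0
Perms-NonEmpty-0↔ = mk↔ₛ′ (⊥-elim ∘ empty) (λ ()) (λ ()) (⊥-elim ∘ empty)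
  where
  empty : ∀ {Q} → Perms (NonEmpty Q) 0 → ⊥
  empty (_ , [ p ]) = ⊥-elim-irr (proj₂ (proj₂ p) (perm-0 (proj₁ p)))

Perms-NonEmpty-suc↔ : ∀ {Q} j → Perms (NonEmpty Q) (suc j) ↔ Perms Q (suc j)
Perms-NonEmpty-suc↔ j = mk↔ₛ′ (λ { (xs , [ p ]) → xs , [ proj₁ p , proj₁ (proj₂ p) ] })
  (λ { (xs , [ p ]) → xs , [ proj₁ p , proj₂ p , length≡suc⇒≢[] (length≡ (proj₁ p)) ] })
  (λ _ → refl) (λ _ → refl)

module Counting (M : ℕ → ℕ) (motzkin : IsMotzkin M) where

  -- The intended counts of ClassA′ (or ClassC′) and of its nonempty members.
  M′ M′₊ : ℕ → ℕ
  M′ zero = 1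
  M′ (suc j) = M j
  M′₊ zero = 0
  M′₊ (suc j) = M j

  private
    Counted : (ℕ → Set) → (ℕ → ℕ) → ℕ → Set
    Counted X f n = ∀ {k} → k ≤ n → X k ↔ Fin (f k)

    resize : ∀ {A : Set} {m m′} → m ≡ m′ → A ↔ Fin m′ → A ↔ Fin m
    resize refl A↔ = A↔

  M-convolution : ∀ N → M (suc N) ≡ Σ≤ N (λ k → M′ k * M (N ∸ k))
  M-convolution zero = begin
    M 1           ≡⟨ proj₁ (proj₂ motzkin) ⟩
    1             ≡⟨ proj₁ motzkin ⟨
    M 0           ≡⟨ *-identityˡ (M 0) ⟨
    1 * M 0       ≡⟨ +-identityʳ (1 * M 0) ⟨
    1 * M 0 + 0   ∎
    where open ≡-Reasoning
  M-convolution (suc m) = trans (proj₂ (proj₂ motzkin) m)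
    (cong₂ _+_ (sym (*-identityˡ (M (suc m)))) (cong sum (map-upTo (λ i → M i * M (m ∸ i)) (suc m))))

  M-convolution-reversed : ∀ N → M (suc N) ≡ Σ≤ N (λ k → M k * M′ (N ∸ k))
  M-convolution-reversed N = begin
    M (suc N)                                ≡⟨ M-convolution N ⟩
    Σ≤ N (λ k → M′ k * M (N ∸ k))            ≡⟨ Σ≤-reverse N (λ k → M′ k * M (N ∸ k)) ⟩
    Σ≤ N (λ k → M′ (N ∸ k) * M (N ∸ (N ∸ k))) ≡⟨ Σ≤-cong N (λ {k} k≤N →
                                                  trans (cong (λ j → M′ (N ∸ k) * M j) (m∸[m∸n]≡n k≤N))
                                                        (*-comm (M′ (N ∸ k)) (M k))) ⟩
    Σ≤ N (λ k → M k * M′ (N ∸ k))            ∎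
    where open ≡-Reasoning

  M-convolution′ : ∀ N → M (suc N) ≡ Σ≤ (suc N) (λ k → M′ k * M′₊ (suc N ∸ k))
  M-convolution′ N = begin
    M (suc N)                                       ≡⟨ M-convolution N ⟩
    Σ≤ N (λ k → M′ k * M (N ∸ k)) ≡⟨ Σ≤-cong N (λ {k} k≤N → cong (λ j → M′ k * M′₊ j) (sym (+-∸-assoc 1 k≤N))) ⟩
    Σ≤ N h                        ≡⟨ +-identityʳ (Σ≤ N h) ⟨
    Σ≤ N h + 0                    ≡⟨ cong (Σ≤ N h +_) last-vanishes ⟨
    Σ≤ N h + h (suc N)            ≡⟨ Σ≤-snoc N h ⟨
    Σ≤ (suc N) h                  ∎
    where
    open ≡-Reasoning
    h = λ k → M′ k * M′₊ (suc N ∸ k)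
    last-vanishes : h (suc N) ≡ 0
    last-vanishes = trans (cong (λ j → M N * M′₊ j) (n∸n≡0 N)) (*-zeroʳ (M N))

  module _ (X X′ : ℕ → Set)
    (X-0 : X 0 ↔ Fin 1) (X′-0 : X′ 0 ↔ Fin 1) (X′-1 : X′ 1 ↔ Fin 1)
    (X-step : ∀ n → Counted X M n → Counted X′ M′ n → X (suc n) ↔ Fin (M (suc n)))
    (X′-step : ∀ n → Counted X′ M′ (suc n) → X′ (suc (suc n)) ↔ Fin (M (suc n)))
    where

    count-both : ∀ n → (X n ↔ Fin (M n)) × (X′ n ↔ Fin (M′ n))
    count-both = <-rec _ step
      where
      M0≡1 = proj₁ motzkin
      step : ∀ n → (∀ {k} → k < n → (X k ↔ Fin (M k)) × (X′ k ↔ Fin (M′ k))) → (X n ↔ Fin (M n)) × (X′ n ↔ Fin (M′ n))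
      step zero _ = subst (λ m → X 0 ↔ Fin m) (sym M0≡1) X-0 , X′-0
      step (suc zero) ih = X-step 0 (λ k≤ → proj₁ (ih (s≤s k≤))) (λ k≤ → proj₂ (ih (s≤s k≤)))
                         , subst (λ m → X′ 1 ↔ Fin m) (sym M0≡1) X′-1
      step (suc (suc n)) ih = X-step (suc n) (λ k≤ → proj₁ (ih (s≤s k≤))) (λ k≤ → proj₂ (ih (s≤s k≤)))
                            , X′-step n (λ k≤ → proj₂ (ih (s≤s k≤)))

  count-NonEmpty : ∀ {Q} n → Counted (Perms Q) M′ n → Counted (Perms (NonEmpty Q)) M′₊ n
  count-NonEmpty n count {zero} _ = Perms-NonEmpty-0↔
  count-NonEmpty n count {suc j} k≤n = ↔-trans (Perms-NonEmpty-suc↔ j) (count k≤n)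

  countA : ∀ n → Perms ClassA n ↔ Fin (M n)
  countA = proj₁ ∘ count-both (Perms ClassA) (Perms ClassA′)
    (Perms-0↔ (avoids-[] R132 R321)) (Perms-0↔ (avoids-[] R132 R321 , λ ()))
    (Perms-1↔ (avoids-singleton R132 R321 0 , λ ())) step step′
    where
    step : ∀ n → Counted (Perms ClassA) M n → Counted (Perms ClassA′) M′ n → Perms ClassA (suc n) ↔ Fin (M (suc n))
    step n count count′ = resize (M-convolution n)
      (↔-trans (decomposeA n) (convolution↔Fin n _ _ M′ M count′ count))
    step′ : ∀ n → Counted (Perms ClassA′) M′ (suc n) → Perms ClassA′ (suc (suc n)) ↔ Fin (M (suc n))
    step′ n count′ = resize (M-convolution′ n)
      (↔-trans (decomposeA′ n) (convolution↔Fin (suc n) _ _ M′ M′₊ count′ (count-NonEmpty (suc n) count′)))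

  countC : ∀ n → Perms ClassC n ↔ Fin (M n)
  countC = proj₁ ∘ count-both (Perms ClassC) (Perms ClassC′)
    (Perms-0↔ (avoids-[] R132 R123)) (Perms-0↔ (avoids-[] R132 R123 , λ ()))
    (Perms-1↔ (avoids-singleton R132 R123 0 , λ ())) step step′
    where
    step : ∀ n → Counted (Perms ClassC) M n → Counted (Perms ClassC′) M′ n → Perms ClassC (suc n) ↔ Fin (M (suc n))
    step n count count′ = resize (M-convolution-reversed n)
      (↔-trans (decomposeC n) (convolution↔Fin n _ _ M M′ count count′))
    step′ : ∀ n → Counted (Perms ClassC′) M′ (suc n) → Perms ClassC′ (suc (suc n)) ↔ Fin (M (suc n))
    step′ n count′ = resize (M-convolution-reversed n)
      (↔-trans (decomposeC′ n) (convolution↔Fin (suc n) _ _ M′₊ M′ (count-NonEmpty (suc n) count′) count′))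

module _ {n : ℕ} where

  values : ∀ {m} → Vec (Fin n) m → List ℕ
  values v = map toℕ (Vec.toList v)

  length-values : ∀ {m} (v : Vec (Fin n) m) → length (values v) ≡ m
  length-values v = trans (length-map toℕ (Vec.toList v)) (Vec.length-toList v)

  values-bounded : ∀ {m} (v : Vec (Fin n) m) → All (_< n) (values v)
  values-bounded v = All.map⁺ (All.tabulate λ {x} _ → toℕ<n x)

  private
    Entry : ∀ {m} → Vec (Fin n) m → Fin m → ℕ
    Entry v i = toℕ (Vec.lookup v i)

  single-⊑ : ∀ {m} (v : Vec (Fin n) m) i → (Entry v i ∷ []) ⊑ values v
  single-⊑ (_ ∷ v) Fin.zero = refl ∷ minimum _
  single-⊑ (x ∷ v) (Fin.suc i) = toℕ x ∷ʳ single-⊑ v i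

  pair-⊑ : ∀ {m} (v : Vec (Fin n) m) {i j} → i Fin.< j → (Entry v i ∷ Entry v j ∷ []) ⊑ values v
  pair-⊑ (_ ∷ v) {Fin.zero} {Fin.suc j} _ = refl ∷ single-⊑ v j
  pair-⊑ (x ∷ v) {Fin.suc i} {Fin.suc j} (s≤s i<j) = toℕ x ∷ʳ pair-⊑ v i<j

  triple-⊑ : ∀ {m} (v : Vec (Fin n) m) {i j k} → i Fin.< j → j Fin.< k →
             (Entry v i ∷ Entry v j ∷ Entry v k ∷ []) ⊑ values v
  triple-⊑ (_ ∷ v) {Fin.zero} {Fin.suc j} {Fin.suc k} _ (s≤s j<k) = refl ∷ pair-⊑ v j<k
  triple-⊑ (x ∷ v) {Fin.suc i} {Fin.suc j} {Fin.suc k} (s≤s i<j) (s≤s j<k) = toℕ x ∷ʳ triple-⊑ v i<j j<k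

  single-⊑⁻ : ∀ {m x} (v : Vec (Fin n) m) → (x ∷ []) ⊑ values v → ∃[ i ] Entry v i ≡ x
  single-⊑⁻ (_ ∷ v) (_ ∷ʳ o) with i , refl ← single-⊑⁻ v o = Fin.suc i , refl
  single-⊑⁻ (_ ∷ v) (refl ∷ _) = Fin.zero , refl

  pair-⊑⁻ : ∀ {m x y} (v : Vec (Fin n) m) → (x ∷ y ∷ []) ⊑ values v →
            ∃[ i ] ∃[ j ] i Fin.< j × Entry v i ≡ x × Entry v j ≡ y
  pair-⊑⁻ (_ ∷ v) (_ ∷ʳ o) with i , j , i<j , refl , refl ← pair-⊑⁻ v o =
    Fin.suc i , Fin.suc j , s≤s i<j , refl , refl
  pair-⊑⁻ (_ ∷ v) (refl ∷ o) with j , refl ← single-⊑⁻ v o = Fin.zero , Fin.suc j , z<s , refl , refl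

  triple-⊑⁻ : ∀ {m x y z} (v : Vec (Fin n) m) → (x ∷ y ∷ z ∷ []) ⊑ values v →
              ∃[ i ] ∃[ j ] ∃[ k ] i Fin.< j × j Fin.< k × Entry v i ≡ x × Entry v j ≡ y × Entry v k ≡ z
  triple-⊑⁻ (_ ∷ v) (_ ∷ʳ o) with i , j , k , i<j , j<k , refl , refl , refl ← triple-⊑⁻ v o =
    Fin.suc i , Fin.suc j , Fin.suc k , s≤s i<j , s≤s j<k , refl , refl , refl
  triple-⊑⁻ (_ ∷ v) (refl ∷ o) with j , k , j<k , refl , refl ← pair-⊑⁻ v o =
    Fin.zero , Fin.suc j , Fin.suc k , z<s , s≤s j<k , refl , refl , refl

  consecutive⇒occurs : ∀ {m R} (v : Vec (Fin n) m) {i j k} → toℕ j ≡ suc (toℕ i) → toℕ k ≡ suc (toℕ j) →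
    R (Entry v i) (Entry v j) (Entry v k) → OccursConsecutively R (values v)
  consecutive⇒occurs (_ ∷ _ ∷ _ ∷ _) {0F} {1F} {2F} refl refl r = inj₁ r
  consecutive⇒occurs (_ ∷ v) {Fin.suc i} {Fin.suc j} {Fin.suc k} j≡ k≡ r =
    inj₂ (consecutive⇒occurs v (suc-injective j≡) (suc-injective k≡) r)
  consecutive⇒occurs _ {0F} {0F} ()
  consecutive⇒occurs _ {0F} {Fin.suc (Fin.suc _)} ()
  consecutive⇒occurs (_ ∷ _ ∷ _) {0F} {1F} {0F} _ ()
  consecutive⇒occurs (_ ∷ _ ∷ _) {0F} {1F} {1F} _ ()
  consecutive⇒occurs (_ ∷ _ ∷ _ ∷ _) {0F} {1F} {Fin.suc (Fin.suc (Fin.suc _))} _ ()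
  consecutive⇒occurs _ {Fin.suc _} {0F} ()
  consecutive⇒occurs (_ ∷ _) {Fin.suc _} {Fin.suc _} {0F} _ ()

  occurs⇒consecutive : ∀ {m R} (v : Vec (Fin n) m) → OccursConsecutively R (values v) →
    ∃[ i ] ∃[ j ] ∃[ k ] toℕ j ≡ suc (toℕ i) × toℕ k ≡ suc (toℕ j) × R (Entry v i) (Entry v j) (Entry v k)
  occurs⇒consecutive (_ ∷ _ ∷ _ ∷ _) (inj₁ r) = 0F , 1F , 2F , refl , refl , r
  occurs⇒consecutive (_ ∷ v) (inj₂ o) with i , j , k , j≡ , k≡ , r ← occurs⇒consecutive v o =
    Fin.suc i , Fin.suc j , Fin.suc k , cong suc j≡ , cong suc k≡ , r

  isPerm⇒unique : ∀ {m} (v : Vec (Fin n) m) → (∀ i j → Vec.lookup v i ≡ Vec.lookup v j → i ≡ j) → Unique (values v)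
  isPerm⇒unique [] _ = []
  isPerm⇒unique (a ∷ v) inj =
    All.tabulate (λ y∈ a≡y → fresh (single-⊑⁻ v (from∈ y∈)) a≡y) ∷
    isPerm⇒unique v (λ i j eq → Fin.suc-injective (inj (Fin.suc i) (Fin.suc j) eq))
    where
    fresh : ∀ {y} → ∃[ i ] Entry v i ≡ y → toℕ a ≢ y
    fresh (i , refl) a≡ with () ← inj Fin.zero (Fin.suc i) (toℕ-injective a≡)

  unique⇒isPerm : ∀ {m} (v : Vec (Fin n) m) → Unique (values v) → ∀ i j → Vec.lookup v i ≡ Vec.lookup v j → i ≡ j
  unique⇒isPerm (a ∷ v) _ Fin.zero Fin.zero _ = refl
  unique⇒isPerm (a ∷ v) (a∉ ∷ _) Fin.zero (Fin.suc j) a≡ =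
    contradiction (cong toℕ a≡) (All.lookup a∉ (⊑-lookup (single-⊑ v j) (here refl)))
  unique⇒isPerm (a ∷ v) (a∉ ∷ _) (Fin.suc i) Fin.zero ≡a =
    contradiction (cong toℕ (sym ≡a)) (All.lookup a∉ (⊑-lookup (single-⊑ v i) (here refl)))
  unique⇒isPerm (a ∷ v) (_ ∷ u) (Fin.suc i) (Fin.suc j) eq = cong Fin.suc (unique⇒isPerm v u i j eq)

increasing₃ : ∀ (h : Fin 3 → ℕ) → h 0F < h 1F → h 1F < h 2F → ∀ {a b} → a Fin.< b → h a < h b
increasing₃ h lt₁ lt₂ {0F} {1F} _ = lt₁
increasing₃ h lt₁ lt₂ {0F} {2F} _ = <-trans lt₁ lt₂
increasing₃ h lt₁ lt₂ {1F} {2F} _ = lt₂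
increasing₃ h _ _ {0F} {0F} ()
increasing₃ h _ _ {1F} {0F} ()
increasing₃ h _ _ {1F} {1F} (s≤s ())
increasing₃ h _ _ {2F} {0F} ()
increasing₃ h _ _ {2F} {1F} (s≤s ())
increasing₃ h _ _ {2F} {2F} (s≤s (s≤s ()))

increasing⇒reflects< : ∀ {m} (h : Fin m → ℕ) → (∀ {a b} → a Fin.< b → h a < h b) →
                       ∀ {a b} → h a < h b → a Fin.< b
increasing⇒reflects< h increasing {a} {b} ha<hb with Fin.<-cmp a b
... | tri< a<b _ _ = a<b
... | tri≈ _ refl _ = contradiction ha<hb (<-irrefl refl)
... | tri> _ _ b<a = contradiction (increasing b<a) (<-asym ha<hb)

module _ (P : Pattern₃) {n : ℕ} (g : Fin 3 → Fin n) where

  open Pattern₃ P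
  private
    σ = Vec.lookup word
    w = Vec.lookup (toℕ (g 0F) ∷ toℕ (g 1F) ∷ toℕ (g 2F) ∷ [])
    h = λ a → toℕ (g (position a))

    w≡ : ∀ a → w a ≡ toℕ (g a)
    w≡ 0F = refl
    w≡ 1F = refl
    w≡ 2F = refl

    g≡ : ∀ i → toℕ (g i) ≡ h (σ i)
    g≡ i = cong (toℕ ∘ g) (sym (position∘word i))

  shape⇒sameRelOrder : Shape P (toℕ (g 0F)) (toℕ (g 1F)) (toℕ (g 2F)) → SameRelOrder g σ
  shape⇒sameRelOrder (lt₁ , lt₂) i j = mk⇔
    (λ gi<gj → increasing⇒reflects< h increasing (subst₂ _<_ (g≡ i) (g≡ j) gi<gj))
    (λ σi<σj → subst₂ _<_ (sym (g≡ i)) (sym (g≡ j)) (increasing σi<σj))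
    where
    increasing = increasing₃ h (subst₂ _<_ (w≡ (position 0F)) (w≡ (position 1F)) lt₁)
                               (subst₂ _<_ (w≡ (position 1F)) (w≡ (position 2F)) lt₂)

  sameRelOrder⇒shape : SameRelOrder g σ → Shape P (toℕ (g 0F)) (toℕ (g 1F)) (toℕ (g 2F))
  sameRelOrder⇒shape same = step 0F 1F z<s , step 1F 2F (s≤s z<s)
    where
    step : ∀ a b → a Fin.< b → w (position a) < w (position b)
    step a b a<b = subst₂ _<_ (sym (w≡ (position a))) (sym (w≡ (position b)))
      (Equivalence.from (same (position a) (position b))
        (subst₂ Fin._<_ (sym (word∘position a)) (sym (word∘position b)) a<b))

module _ (P : Pattern₃) {n : ℕ} (π : Vec (Fin n) n) where

  open Pattern₃ P

  contains⇒occurs : ContainsClassical π word → Occurs (Shape P) (values π)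
  contains⇒occurs (f , increasing , same) =
    _ , _ , _ , triple-⊑ π (increasing 0F 1F z<s) (increasing 1F 2F (s≤s z<s)) ,
    sameRelOrder⇒shape P (Vec.lookup π ∘ f) same

  occurs⇒contains : Occurs (Shape P) (values π) → ContainsClassical π word
  occurs⇒contains (_ , _ , _ , o , r) with i , j , k , i<j , j<k , refl , refl , refl ← triple-⊑⁻ π o =
    f , (λ a b → increasing₃ (toℕ ∘ f) i<j j<k) , shape⇒sameRelOrder P (Vec.lookup π ∘ f) r
    where f = Vec.lookup (i ∷ j ∷ k ∷ [])

  containsConsecutive⇒occurs : ContainsConsecutive π word → OccursConsecutively (Shape P) (values π)
  containsConsecutive⇒occurs (f , adjacent , same) =
    consecutive⇒occurs π (adjacent 0F 1F refl) (adjacent 1F 2F refl) (sameRelOrder⇒shape P (Vec.lookup π ∘ f) same)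

  occurs⇒containsConsecutive : OccursConsecutively (Shape P) (values π) → ContainsConsecutive π word
  occurs⇒containsConsecutive o with i , j , k , j≡ , k≡ , r ← occurs⇒consecutive π o =
    f , adjacent , shape⇒sameRelOrder P (Vec.lookup π ∘ f) r
    where
    f = Vec.lookup (i ∷ j ∷ k ∷ [])
    adjacent : ∀ a b → toℕ b ≡ suc (toℕ a) → toℕ (f b) ≡ suc (toℕ (f a))
    adjacent 0F 1F _ = j≡
    adjacent 1F 2F _ = k≡
    adjacent 0F 0F ()
    adjacent 0F 2F ()
    adjacent 1F 0F ()
    adjacent 1F 1F ()
    adjacent 2F 0F ()
    adjacent 2F 1F ()
    adjacent 2F 2F ()

module _ {n : ℕ} where

  -- Entries out of range, and missing entries, become 0; only the round trip on permutations matters.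
  fromValues : ∀ {m} → List ℕ → Vec (Fin (suc n)) m
  fromValues {zero} _ = []
  fromValues {suc m} [] = Fin.zero ∷ fromValues []
  fromValues {suc m} (x ∷ xs) = x mod suc n ∷ fromValues xs

  values-fromValues : ∀ {m xs} → length xs ≡ m → All (_< suc n) xs → values (fromValues {m} xs) ≡ xs
  values-fromValues {zero} {[]} _ _ = refl
  values-fromValues {suc m} {x ∷ xs} eq (x< ∷ xs<) =
    cong₂ _∷_ (trans (toℕ-fromℕ< _) (m<n⇒m%n≡m x<)) (values-fromValues (suc-injective eq) xs<)

  fromValues-values : ∀ {m} (v : Vec (Fin (suc n)) m) → fromValues (values v) ≡ v
  fromValues-values [] = refl
  fromValues-values (a ∷ v) =
    cong₂ _∷_ (toℕ-injective (trans (toℕ-fromℕ< _) (m<n⇒m%n≡m (toℕ<n a)))) (fromValues-values v)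

vector : ∀ {n} → List ℕ → Vec (Fin n) n
vector {zero} _ = []
vector {suc n} = fromValues

values-vector : ∀ {n xs} → Perm n xs → values (vector {n} xs) ≡ xs
values-vector {zero} {[]} _ = refl
values-vector {suc n} p = values-fromValues (length≡ p) (bounded p)

vector-values : ∀ {n} (v : Vec (Fin n) n) → vector (values v) ≡ v
vector-values {zero} [] = refl
vector-values {suc n} v = fromValues-values v

Av↔Perms : ∀ (P Q : Pattern₃) n → Av n (Pattern₃.word P) (Pattern₃.word Q) ↔ Perms (Avoids (Shape P) (Shape Q)) n
Av↔Perms P Q n = mk↔ₛ′ to from to∘from from∘to
  where
  to : Av n (Pattern₃.word P) (Pattern₃.word Q) → Perms (Avoids (Shape P) (Shape Q)) n
  to (π , [ p ]) = values π ,
    [ mkPerm (isPerm⇒unique π (proj₁ p)) (values-bounded π) (length-values π)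
    , proj₁ (proj₂ p) ∘ occurs⇒contains P π
    , proj₂ (proj₂ p) ∘ occurs⇒containsConsecutive Q π ]

  from : Perms (Avoids (Shape P) (Shape Q)) n → Av n (Pattern₃.word P) (Pattern₃.word Q)
  from (xs , [ p ]) = vector xs , [ (let same = values-vector (proj₁ p) in
      unique⇒isPerm (vector xs) (subst Unique (sym same) (unique (proj₁ p)))
    , proj₁ (proj₂ p) ∘ subst (Occurs (Shape P)) same ∘ contains⇒occurs P (vector xs)
    , proj₂ (proj₂ p) ∘ subst (OccursConsecutively (Shape Q)) same ∘ containsConsecutive⇒occurs Q (vector xs)) ]

  to∘from : ∀ x → to (from x) ≡ x
  to∘from (xs , [ p ]) = value-injective (recompute-≡ (values-vector (proj₁ p)))

  from∘to : ∀ x → from (to x) ≡ x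
  from∘to (π , _) = value-injective (vector-values π)

-- Reversal

opposite-reverses< : ∀ {m} {i j : Fin m} → i Fin.< j → Fin.opposite j Fin.< Fin.opposite i
opposite-reverses< {m} {i} {j} i<j = subst₂ _<_ (sym (Fin.opposite-prop j)) (sym (Fin.opposite-prop i))
  (∸-monoʳ-< (s≤s i<j) (toℕ<n j))

opposite-adjacent : ∀ {m} {i j : Fin m} → toℕ j ≡ suc (toℕ i) → toℕ (Fin.opposite i) ≡ suc (toℕ (Fin.opposite j))
opposite-adjacent {suc m} {i} {j} j≡ = begin
  toℕ (Fin.opposite i)         ≡⟨ Fin.opposite-prop i ⟩
  suc m ∸ suc (toℕ i)          ≡⟨ +-∸-assoc 1 (subst (_≤ m) j≡ (m<1+n⇒m≤n (toℕ<n j))) ⟩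
  suc (m ∸ suc (toℕ i))        ≡⟨ cong (λ l → suc (suc m ∸ suc l)) j≡ ⟨
  suc (suc m ∸ suc (toℕ j))    ≡⟨ cong suc (Fin.opposite-prop j) ⟨
  suc (toℕ (Fin.opposite j))   ∎
  where open ≡-Reasoning

-- Defined by opposite indices rather than as Vec.reverse, so that lookup-reverse is lookup∘tabulate.
reverse : ∀ {n m} → Vec (Fin n) m → Vec (Fin n) m
reverse v = Vec.tabulate (Vec.lookup v ∘ Fin.opposite)

lookup-reverse : ∀ {n m} (v : Vec (Fin n) m) i → Vec.lookup (reverse v) i ≡ Vec.lookup v (Fin.opposite i)
lookup-reverse v = Vec.lookup∘tabulate (Vec.lookup v ∘ Fin.opposite)

reverse-involutive : ∀ {n m} (v : Vec (Fin n) m) → reverse (reverse v) ≡ v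
reverse-involutive v = trans (Vec.tabulate-cong twice) (Vec.tabulate∘lookup v)
  where
  twice : ∀ i → Vec.lookup (reverse v) (Fin.opposite i) ≡ Vec.lookup v i
  twice i = trans (lookup-reverse v (Fin.opposite i)) (cong (Vec.lookup v) (Fin.opposite-involutive i))

module _ {n k : ℕ} {π : Vec (Fin n) n} {σ : Vec (Fin k) k} where

  private
    reindex : (Fin k → Fin n) → Fin k → Fin n
    reindex f = Fin.opposite ∘ f ∘ Fin.opposite

    same-reverse : ∀ f → SameRelOrder (Vec.lookup π ∘ f) (Vec.lookup σ) →
                   SameRelOrder (Vec.lookup (reverse π) ∘ reindex f) (Vec.lookup (reverse σ))
    same-reverse f same i j
      rewrite lookup-reverse π (reindex f i) | lookup-reverse π (reindex f j)
            | Fin.opposite-involutive (f (Fin.opposite i)) | Fin.opposite-involutive (f (Fin.opposite j))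
            | lookup-reverse σ i | lookup-reverse σ j
      = same (Fin.opposite i) (Fin.opposite j)

  contains-reverse : ContainsClassical π σ → ContainsClassical (reverse π) (reverse σ)
  contains-reverse (f , increasing , same) =
    reindex f , (λ i j i<j → opposite-reverses< (increasing _ _ (opposite-reverses< i<j))) , same-reverse f same

  containsConsecutive-reverse : ContainsConsecutive π σ → ContainsConsecutive (reverse π) (reverse σ)
  containsConsecutive-reverse (f , adjacent , same) =
    reindex f , (λ i j j≡ → opposite-adjacent (adjacent _ _ (opposite-adjacent j≡))) , same-reverse f same

isPerm-reverse : ∀ {n} {π : Vec (Fin n) n} → IsPerm π → IsPerm (reverse π)
isPerm-reverse {π = π} injective i j eq = begin
  i                                   ≡⟨ Fin.opposite-involutive i ⟨
  Fin.opposite (Fin.opposite i)       ≡⟨ cong Fin.opposite (injective _ _ (begin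
    Vec.lookup π (Fin.opposite i)       ≡⟨ lookup-reverse π i ⟨
    Vec.lookup (reverse π) i            ≡⟨ eq ⟩
    Vec.lookup (reverse π) j            ≡⟨ lookup-reverse π j ⟩
    Vec.lookup π (Fin.opposite j)       ∎)) ⟩
  Fin.opposite (Fin.opposite j)       ≡⟨ Fin.opposite-involutive j ⟩
  j                                   ∎
  where open ≡-Reasoning

Av-reverse : ∀ n {k l} (τ : Vec (Fin k) k) (ρ : Vec (Fin l) l) → Av n τ ρ ↔ Av n (reverse τ) (reverse ρ)
Av-reverse n τ ρ = mk↔ₛ′ to from
  (λ { (π , _) → value-injective (reverse-involutive π) })
  (λ { (π , _) → value-injective (reverse-involutive π) })
  where
  to : Av n τ ρ → Av n (reverse τ) (reverse ρ)
  to (π , [ p ]) = reverse π ,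
    [ isPerm-reverse {π = π} (proj₁ p)
    , proj₁ (proj₂ p) ∘ subst₂ ContainsClassical (reverse-involutive π) (reverse-involutive τ)
                      ∘ contains-reverse {π = reverse π} {σ = reverse τ}
    , proj₂ (proj₂ p) ∘ subst₂ ContainsConsecutive (reverse-involutive π) (reverse-involutive ρ)
                      ∘ containsConsecutive-reverse {π = reverse π} {σ = reverse ρ} ]

  from : Av n (reverse τ) (reverse ρ) → Av n τ ρ
  from (π , [ p ]) = reverse π ,
    [ isPerm-reverse {π = π} (proj₁ p)
    , proj₁ (proj₂ p) ∘ subst (λ x → ContainsClassical x (reverse τ)) (reverse-involutive π)
                      ∘ contains-reverse {π = reverse π} {σ = τ}
    , proj₂ (proj₂ p) ∘ subst (λ x → ContainsConsecutive x (reverse ρ)) (reverse-involutive π)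
                      ∘ containsConsecutive-reverse {π = reverse π} {σ = ρ} ]

-- Motzkin numbers

-- Recursion on fuel, which only has to exceed the index (motzkin-fuel-stable).
motzkinᶠ : ℕ → ℕ → ℕ
motzkinᶠ zero _ = 0
motzkinᶠ (suc f) zero = 1
motzkinᶠ (suc f) (suc zero) = 1
motzkinᶠ (suc f) (suc (suc m)) = motzkinᶠ f (suc m) + Σ≤ m (λ i → motzkinᶠ f i * motzkinᶠ f (m ∸ i))

motzkin-fuel-stable : ∀ f g n → n < f → n < g → motzkinᶠ f n ≡ motzkinᶠ g n
motzkin-fuel-stable (suc f) (suc g) zero _ _ = refl
motzkin-fuel-stable (suc f) (suc g) (suc zero) _ _ = refl
motzkin-fuel-stable (suc f) (suc g) (suc (suc m)) (s≤s m<f) (s≤s m<g) =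
  cong₂ _+_ (motzkin-fuel-stable f g (suc m) m<f m<g)
            (Σ≤-cong m λ {k} k≤m → cong₂ _*_ (stable k k≤m) (stable (m ∸ k) (m∸n≤m m k)))
  where
  stable : ∀ k → k ≤ m → motzkinᶠ f k ≡ motzkinᶠ g k
  stable k k≤m = motzkin-fuel-stable f g k (<-trans (s≤s k≤m) m<f) (<-trans (s≤s k≤m) m<g)

motzkin : ℕ → ℕ
motzkin n = motzkinᶠ (suc n) n

motzkin-recurrence : ∀ m → motzkin (suc (suc m)) ≡
  motzkin (suc m) + sum (map (λ i → motzkin i * motzkin (m ∸ i)) (upTo (suc m)))
motzkin-recurrence m = cong (motzkin (suc m) +_) (begin
  Σ≤ m (λ i → motzkinᶠ (suc (suc m)) i * motzkinᶠ (suc (suc m)) (m ∸ i))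
    ≡⟨ Σ≤-cong m (λ {k} k≤m → cong₂ _*_ (stable k≤m) (stable (m∸n≤m m k))) ⟩
  Σ≤ m (λ i → motzkin i * motzkin (m ∸ i))
    ≡⟨ cong sum (map-upTo (λ i → motzkin i * motzkin (m ∸ i)) (suc m)) ⟨
  sum (map (λ i → motzkin i * motzkin (m ∸ i)) (upTo (suc m)))   ∎)
  where
  open ≡-Reasoning
  stable : ∀ {k} → k ≤ m → motzkinᶠ (suc (suc m)) k ≡ motzkin k
  stable {k} k≤m = motzkin-fuel-stable _ _ k (s≤s (m≤n⇒m≤1+n k≤m)) ≤-refl

motzkin-isMotzkin : IsMotzkin motzkin
motzkin-isMotzkin = refl , refl , motzkin-recurrence

corollary6p6 : (n : ℕ) → 1 ≤ n →
    (Av n p132 p321 ↔ Av n p231 p321) × (Av n p132 p321 ↔ Av n p132 p123)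
    × ((M : ℕ → ℕ) → IsMotzkin M → Av n p132 p321 ↔ Fin (M n))
corollary6p6 n _ = ↔-trans A↔C (↔-sym B↔C) , A↔C , countA
  where
  countA : (M : ℕ → ℕ) → IsMotzkin M → Av n p132 p321 ↔ Fin (M n)
  countA M motzkin-M = ↔-trans (Av↔Perms pat132 pat321 n) (Counting.countA M motzkin-M n)

  countC : Av n p132 p123 ↔ Fin (motzkin n)
  countC = ↔-trans (Av↔Perms pat132 pat123 n) (Counting.countC motzkin motzkin-isMotzkin n)

  A↔C : Av n p132 p321 ↔ Av n p132 p123
  A↔C = ↔-trans (countA motzkin motzkin-isMotzkin) (↔-sym countC)

  -- reverse p231 and reverse p321 compute to p132 and p123.
  B↔C : Av n p231 p321 ↔ Av n p132 p123
  B↔C = Av-reverse n p231 p321
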